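{- Let $k,n \geq 1$ be integers, let $D$ be a strongly $k$-connected digraph, and let $U \subseteq V(D)$ with $|U| \leq |V(D)|-k$. Then there is a $k$-escaper $(E_{\rm escape} , U , U_{\rm out})$ in $D$ such that $|E_{\rm escape}| \leq 4k|U|$ and $|U_{\rm out}| \leq 2k|U|$.
   Context: A digraph is a pair $(V,E)$ with $E\subseteq (V\times V)\setminus\{(v,v)\}$; it is strongly $k$-connected if $|V(D)|\geq k+1$ and $D-S$ is strongly connected for every $S\subseteq V(D)$ with $|S|\leq k-1$. A $k$-escaper in $D$ is a triple $(E_{\rm escape},U,U_{\rm out})$ with $E_{\rm escape}\subseteq E(D)$ and $U,U_{\rm out}\subseteq V(D)$ such that (E1) $U_{\rm out}\subseteq V(D)\setminus U$; (E2) for every $S\subseteq V(D)$ with $|S|\leq k-1$ and every $u\in U\setminus S$, $D-S$ contains a path from $u$ to a vertex of $U_{\rm out}$ using only edges in $E_{\rm escape}$; (E3) for every such $S$ and every $v\in U\setminus S$, $D-S$ contains a path from a vertex of $U_{\rm out}$ to $v$ using only edges in $E_{\rm escape}$. -}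

module Defs where

open import Data.Nat using (ℕ; _≤_; _∸_; _*_; _+_)
open import Data.Bool using (Bool; true; false)
open import Data.Fin using (Fin)
open import Data.Fin.Subset using (Subset; _∈_; _∉_; ∣_∣; _⊆_)
open import Data.Vec using (tabulate)
open import Data.List using (map; allFin)
open import Data.Nat.ListAction using (sum)
open import Data.Product using (Σ; _×_; ∃-syntax)
open import Relation.Binary.PropositionalEquality using (_≡_)

record Digraph : Set where
  field
    N        : ℕ
    adj      : Fin N → Fin N → Bool
    loopless : ∀ v → adj v v ≡ false
open Digraph public

EdgeSet : ℕ → Set
EdgeSet N = Fin N → Fin N → Bool

_⊆E_ : (D : Digraph) → EdgeSet (N D) → Set
D ⊆E F = ∀ u v → F u v ≡ true → adj D u v ≡ true

edgeCount : ∀ {N} → EdgeSet N → ℕ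
edgeCount {N} F = sum (map (λ u → ∣ tabulate (F u) ∣) (allFin N))

data PathAvoiding {N : ℕ} (F : EdgeSet N) (S : Subset N) : Fin N → Fin N → Set where
  here : ∀ {u} → u ∉ S → PathAvoiding F S u u
  step : ∀ {u w v} → u ∉ S → F u w ≡ true → PathAvoiding F S w v → PathAvoiding F S u v

StronglyConnectedMinus : (D : Digraph) → Subset (N D) → Set
StronglyConnectedMinus D S = ∀ u v → u ∉ S → v ∉ S → PathAvoiding (adj D) S u v

StronglyKConnected : ℕ → Digraph → Set
StronglyKConnected k D =
  (k + 1 ≤ N D) × (∀ (S : Subset (N D)) → ∣ S ∣ ≤ k ∸ 1 → StronglyConnectedMinus D S)

record IsEscaper (k : ℕ) (D : Digraph) (E : EdgeSet (N D)) (U Uout : Subset (N D)) : Set where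
  field
    E⊆     : D ⊆E E
    E1     : ∀ x → x ∈ Uout → x ∉ U
    E2     : ∀ (S : Subset (N D)) → ∣ S ∣ ≤ k ∸ 1 → ∀ u → u ∈ U → u ∉ S →
               ∃[ w ] (w ∈ Uout × PathAvoiding E S u w)
    E3     : ∀ (S : Subset (N D)) → ∣ S ∣ ≤ k ∸ 1 → ∀ v → v ∈ U → v ∉ S →
               ∃[ w ] (w ∈ Uout × PathAvoiding E S w v)

-- Call an edge set F expanding if every nonempty X ⊆ U has at least k out-neighbours
-- outside X.  Strong k-connectivity and |U| ≤ |V(D)| - k make E(D) expanding: a smaller
-- boundary S would separate X from a vertex outside X ∪ S.  Expansion alone gives the escape
-- property: the set of vertices of U reachable from u in F - S (|S| < k) has more boundary
-- vertices than S, so it keeps growing until a path leaves U.  Now take F ⊆ E(D) edge-minimal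
-- among expanding sets of edges leaving U.  Deleting an edge x → y destroys expansion, so some
-- tight set (boundary of size exactly k) contains x but not y.  By submodularity of the
-- boundary size, tight sets containing x are closed under intersection, and a minimal one
-- misses every out-neighbour of x; these all lie on its boundary, so x has out-degree at
-- most k and |F| ≤ k|U|.  The same construction in the reversed digraph handles paths into
-- U, and U_out consists of the heads of both edge sets outside U.

module Submission where

open import Defs
open import Data.Nat using (ℕ; zero; suc; _+_; _*_; _∸_; _≤_; _<_; z≤n; _<?_)
open import Data.Nat.Properties hiding (_≟_)
open import Data.Nat.Induction using (<-wellFounded)
open import Data.Nat.Solver using (module +-*-Solver)
import Data.Nat.ListAction as ListNat
open import Algebra.Properties.Semiring.Sum +-*-semiring
  using (sum; ∑-distrib-+; ∑-comm; *-distribˡ-sum; sum-cong-≗)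
open import Data.Bool using (Bool; true; false; _∧_; _∨_; not)
open import Data.Bool.Properties
  using (∧-zeroʳ; ∨-zeroʳ; ∧-conicalˡ; ∧-conicalʳ; ∨-conicalˡ; ∨-conicalʳ; ¬-not; not-¬) renaming (_≟_ to _≟ᵇ_)
open import Data.Empty using (⊥; ⊥-elim)
open import Data.Fin using (Fin; zero; suc; _≟_)
open import Data.Fin.Properties using (any?; all?)
open import Data.Fin.Subset using (Subset; ∣_∣; _∈_; _∉_)
open import Data.Fin.Subset.Properties using (anySubset?)
import Data.List as List
open import Data.List.Properties using (map-tabulate)
open import Data.Product using (_×_; ∃-syntax; _,_; proj₁; proj₂)
open import Data.Sum using (_⊎_; inj₁; inj₂)
open import Data.Vec using (lookup; tabulate)
open import Data.Vec.Properties using ([]=⇒lookup; lookup⇒[]=; lookup∘tabulate; tabulate∘lookup)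
open import Function using (_∘_)
open import Induction.WellFounded using (Acc; acc)
open import Relation.Binary.PropositionalEquality
open import Relation.Nullary using (¬_; Dec; yes; no; does)
open import Relation.Nullary.Decidable using (_×-dec_; _→-dec_; ¬?; dec-true; dec-false)

private variable
  n : ℕ

descend : {A : Set} {P Q : A → Set} (size : A → ℕ) →
          (∀ a → P a → Q a ⊎ ∃[ b ] (P b × size b < size a)) →
          ∀ {a} → P a → ∃[ b ] (P b × Q b)
descend {P = P} {Q = Q} size descent {a} = go a (<-wellFounded (size a))
  where
  go : ∀ a → Acc _<_ (size a) → P a → ∃[ b ] (P b × Q b)
  go a (acc smaller) pa with descent a pa
  ... | inj₁ qa = a , pa , qa
  ... | inj₂ (b , pb , b<a) = go b (smaller b<a) pb

sum-mono-≤ : {f g : Fin n → ℕ} → (∀ i → f i ≤ g i) → sum f ≤ sum g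
sum-mono-≤ {zero} _ = z≤n
sum-mono-≤ {suc n} f≤g = +-mono-≤ (f≤g zero) (sum-mono-≤ (f≤g ∘ suc))

sum-mono-< : {f g : Fin n → ℕ} → (∀ i → f i ≤ g i) → ∀ j → f j < g j → sum f < sum g
sum-mono-< f≤g zero fj<gj = +-mono-<-≤ fj<gj (sum-mono-≤ (f≤g ∘ suc))
sum-mono-< f≤g (suc j) fj<gj = +-mono-≤-< (f≤g zero) (sum-mono-< (f≤g ∘ suc) j fj<gj)

bit : Bool → ℕ
bit true = 1
bit false = 0

bit-mono : {a b : Bool} → (a ≡ true → b ≡ true) → bit a ≤ bit b
bit-mono {false} _ = z≤n
bit-mono {true} a⇒b rewrite a⇒b refl = ≤-refl

bit-∧ˡ : ∀ a b → bit (a ∧ b) ≤ bit a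
bit-∧ˡ true b = bit-mono (λ _ → refl)
bit-∧ˡ false b = z≤n

bit-∧ʳ : ∀ a b → bit (a ∧ b) ≤ bit b
bit-∧ʳ true b = ≤-refl
bit-∧ʳ false b = z≤n

bit-∧+∨ : ∀ a b → bit (a ∧ b) + bit (a ∨ b) ≡ bit a + bit b
bit-∧+∨ true b = +-comm (bit b) 1
bit-∧+∨ false b = refl

bit-∨ : ∀ a b → bit (a ∨ b) ≤ bit a + bit b
bit-∨ a b = ≤-trans (m≤n+m _ (bit (a ∧ b))) (≤-reflexive (bit-∧+∨ a b))

bit-submodular : ∀ x y gx gy →
  bit (not (x ∧ y) ∧ (gx ∧ gy)) + bit (not (x ∨ y) ∧ (gx ∨ gy)) ≤ bit (not x ∧ gx) + bit (not y ∧ gy)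
bit-submodular true true gx gy = z≤n
bit-submodular true false gx gy = ≤-trans (≤-reflexive (+-identityʳ _)) (bit-∧ʳ gx gy)
bit-submodular false true gx gy = +-monoˡ-≤ 0 (bit-∧ˡ gx gy)
bit-submodular false false gx gy = ≤-reflexive (bit-∧+∨ gx gy)

VSet : ℕ → Set
VSet n = Fin n → Bool

count : VSet n → ℕ
count P = sum (bit ∘ P)

infix 4 _⊑_
infixr 7 _∩_
infixr 6 _∪_

_⊑_ : VSet n → VSet n → Set
P ⊑ Q = ∀ i → P i ≡ true → Q i ≡ true

_∩_ : VSet n → VSet n → VSet n
(P ∩ Q) i = P i ∧ Q i

_∪_ : VSet n → VSet n → VSet n
(P ∪ Q) i = P i ∨ Q i

∁ : VSet n → VSet n
∁ P i = not (P i)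

⁅_⁆ : Fin n → VSet n
⁅ z ⁆ i = does (i ≟ z)

NonEmpty : VSet n → Set
NonEmpty P = ∃[ i ] P i ≡ true

any : VSet n → Bool
any {zero} _ = false
any {suc n} P = P zero ∨ any (P ∘ suc)

∩-monoʳ : {P Q R : VSet n} → Q ⊑ R → (P ∩ Q) ⊑ (P ∩ R)
∩-monoʳ {P = P} Q⊑R i PQi with P i
... | true = Q⊑R i PQi

∩-⊑ˡ : (P Q : VSet n) → P ∩ Q ⊑ P
∩-⊑ˡ P Q i PQi = ∧-conicalˡ (P i) (Q i) PQi

∩-⊑ʳ : (P Q : VSet n) → P ∩ Q ⊑ Q
∩-⊑ʳ P Q i PQi = ∧-conicalʳ (P i) (Q i) PQi

⊑-∪ˡ : (P Q : VSet n) → P ⊑ (P ∪ Q)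
⊑-∪ˡ P Q i Pi rewrite Pi = refl

⊑-∪ʳ : (P Q : VSet n) → Q ⊑ (P ∪ Q)
⊑-∪ʳ P Q i Qi with P i
... | true = refl
... | false = Qi

∪-⊑ : {P Q R : VSet n} → P ⊑ R → Q ⊑ R → (P ∪ Q) ⊑ R
∪-⊑ {P = P} P⊑R Q⊑R i PQi with P i in Pi
... | true = P⊑R i Pi
... | false = Q⊑R i PQi

∁-antitone : {P Q : VSet n} → P ⊑ Q → ∁ Q ⊑ ∁ P
∁-antitone {P = P} P⊑Q i ∁Qi with P i in Pi
... | false = refl
... | true with () ← trans (sym ∁Qi) (cong not (P⊑Q i Pi))

separated⇒≢ : (P : VSet n) {a b : Fin n} → P a ≡ true → P b ≡ false → a ≢ b
separated⇒≢ P Pa Pb refl with () ← trans (sym Pa) Pb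

⁅⁆-self : (z : Fin n) → ⁅ z ⁆ z ≡ true
⁅⁆-self z = dec-true (z ≟ z) refl

⁅⁆-sound : {i z : Fin n} → ⁅ z ⁆ i ≡ true → i ≡ z
⁅⁆-sound {i = i} {z} z∋i with i ≟ z
... | yes i≡z = i≡z

⁅⁆-≢ : {i z : Fin n} → i ≢ z → ⁅ z ⁆ i ≡ false
⁅⁆-≢ {i = i} {z} = dec-false (i ≟ z)

∪⁅⁆-intro : (R : VSet n) {z i : Fin n} → (i ≢ z → R i ≡ true) → (R ∪ ⁅ z ⁆) i ≡ true
∪⁅⁆-intro R {z} {i} R∋i with i ≟ z
... | yes _ = ∨-zeroʳ (R i)
... | no i≢z rewrite R∋i i≢z = refl

∪⁅⁆-elim : (R : VSet n) {z i : Fin n} → (R ∪ ⁅ z ⁆) i ≡ true → R i ≡ true ⊎ i ≡ z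
∪⁅⁆-elim R {i = i} R∪z∋i with R i
... | true = inj₁ refl
... | false = inj₂ (⁅⁆-sound R∪z∋i)

any-intro : (P : VSet n) (i : Fin n) → P i ≡ true → any P ≡ true
any-intro P zero Pi rewrite Pi = refl
any-intro P (suc i) Pi with P zero
... | true = refl
... | false = any-intro (P ∘ suc) i Pi

any-elim : (P : VSet n) → any P ≡ true → NonEmpty P
any-elim {suc n} P anyP with P zero in P0
... | true = zero , P0
... | false with any-elim (P ∘ suc) anyP
... | i , Pi = suc i , Pi

count-mono : {P Q : VSet n} → P ⊑ Q → count P ≤ count Q
count-mono P⊑Q = sum-mono-≤ (λ i → bit-mono (P⊑Q i))

count-⊂ : {P Q : VSet n} → P ⊑ Q → ∀ j → P j ≡ false → Q j ≡ true → count P < count Q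
count-⊂ P⊑Q j Pj Qj = sum-mono-< (λ i → bit-mono (P⊑Q i)) j (subst₂ (λ p q → bit p < bit q) (sym Pj) (sym Qj) ≤-refl)

count-∪ : (P Q : VSet n) → count (P ∪ Q) ≤ count P + count Q
count-∪ P Q = ≤-trans (sum-mono-≤ (λ i → bit-∨ (P i) (Q i))) (≤-reflexive (∑-distrib-+ (bit ∘ P) (bit ∘ Q)))

count-∅ : count {n} (λ _ → false) ≡ 0
count-∅ {zero} = refl
count-∅ {suc n} = count-∅ {n}

count-full : count {n} (λ _ → true) ≡ n
count-full {zero} = refl
count-full {suc n} = cong suc (count-full {n})

count-⁅⁆ : (z : Fin n) → count ⁅ z ⁆ ≡ 1
count-⁅⁆ {suc n} zero = cong suc (count-∅ {n})
count-⁅⁆ (suc z) = count-⁅⁆ z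

count-<⇒∃ : (P Q : VSet n) → count Q < count P → ∃[ i ] (P i ≡ true × Q i ≡ false)
count-<⇒∃ P Q Q<P with any? (λ i → (P i ≟ᵇ true) ×-dec (Q i ≟ᵇ false))
... | yes witness = witness
... | no none = ⊥-elim (<⇒≱ Q<P (count-mono P⊑Q))
  where
  P⊑Q : P ⊑ Q
  P⊑Q i Pi = ¬-not (λ Qi≡false → none (i , Pi , Qi≡false))

bit-any≤count : (P : VSet n) → bit (any P) ≤ count P
bit-any≤count {zero} P = z≤n
bit-any≤count {suc n} P = ≤-trans (bit-∨ (P zero) _) (+-monoʳ-≤ (bit (P zero)) (bit-any≤count (P ∘ suc)))

∣tabulate∣≡count : (P : VSet n) → ∣ tabulate P ∣ ≡ count P
∣tabulate∣≡count {zero} P = refl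
∣tabulate∣≡count {suc n} P with P zero
... | true = cong suc (∣tabulate∣≡count (P ∘ suc))
... | false = ∣tabulate∣≡count (P ∘ suc)

∣∣≡count : (S : Subset n) → ∣ S ∣ ≡ count (lookup S)
∣∣≡count S = trans (cong ∣_∣ (sym (tabulate∘lookup S))) (∣tabulate∣≡count (lookup S))

lookup≡false⇒∉ : {S : Subset n} {i : Fin n} → lookup S i ≡ false → i ∉ S
lookup≡false⇒∉ Si i∈S with () ← trans (sym Si) ([]=⇒lookup i∈S)

∈-tabulate : {P : VSet n} {i : Fin n} → P i ≡ true → i ∈ tabulate P
∈-tabulate {P = P} {i} Pi = lookup⇒[]= i (tabulate P) (trans (lookup∘tabulate P i) Pi)

∈-tabulate⁻ : {P : VSet n} {i : Fin n} → i ∈ tabulate P → P i ≡ true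
∈-tabulate⁻ {P = P} {i} i∈P = trans (sym (lookup∘tabulate P i)) ([]=⇒lookup i∈P)

∉-tabulate : {P : VSet n} {i : Fin n} → P i ≡ false → i ∉ tabulate P
∉-tabulate {P = P} {i} Pi = lookup≡false⇒∉ (trans (lookup∘tabulate P i) Pi)

_⊑ᵉ_ : EdgeSet n → EdgeSet n → Set
F ⊑ᵉ G = ∀ a b → F a b ≡ true → G a b ≡ true

infix 10 _ᵀ
infixr 6 _∪ᵉ_

_ᵀ : EdgeSet n → EdgeSet n
(F ᵀ) a b = F b a

_∪ᵉ_ : EdgeSet n → EdgeSet n → EdgeSet n
(F ∪ᵉ G) a = F a ∪ G a

edges : EdgeSet n → ℕ
edges F = sum (count ∘ F)

heads : EdgeSet n → VSet n
heads F b = any ((F ᵀ) b)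

delete : Fin n → Fin n → EdgeSet n → EdgeSet n
delete x y F a b = F a b ∧ not (⁅ x ⁆ a ∧ ⁅ y ⁆ b)

∪ᵉ-⊑ᵉ : {F G H : EdgeSet n} → F ⊑ᵉ H → G ⊑ᵉ H → (F ∪ᵉ G) ⊑ᵉ H
∪ᵉ-⊑ᵉ F⊑H G⊑H a = ∪-⊑ (F⊑H a) (G⊑H a)

edgeCount≡edges : (F : EdgeSet n) → edgeCount F ≡ edges F
edgeCount≡edges F = begin
  ListNat.sum (List.map (λ a → ∣ tabulate (F a) ∣) (List.tabulate (λ a → a)))
    ≡⟨ cong ListNat.sum (map-tabulate (λ a → a) (λ a → ∣ tabulate (F a) ∣)) ⟩
  ListNat.sum (List.tabulate (λ a → ∣ tabulate (F a) ∣))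
    ≡⟨ list-sum (λ a → ∣ tabulate (F a) ∣) ⟩
  sum (λ a → ∣ tabulate (F a) ∣)
    ≡⟨ sum-cong-≗ (∣tabulate∣≡count ∘ F) ⟩
  edges F ∎
  where
  open ≡-Reasoning
  list-sum : ∀ {m} (f : Fin m → ℕ) → ListNat.sum (List.tabulate f) ≡ sum f
  list-sum {zero} f = refl
  list-sum {suc m} f = cong (f zero +_) (list-sum (f ∘ suc))

edges-ᵀ : (F : EdgeSet n) → edges (F ᵀ) ≡ edges F
edges-ᵀ F = ∑-comm (λ a b → bit (F b a))

edges-∪ᵉ : (F G : EdgeSet n) → edges (F ∪ᵉ G) ≤ edges F + edges G
edges-∪ᵉ F G = ≤-trans (sum-mono-≤ (λ a → count-∪ (F a) (G a))) (≤-reflexive (∑-distrib-+ (count ∘ F) (count ∘ G)))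

count-heads≤edges : (F : EdgeSet n) → count (heads F) ≤ edges F
count-heads≤edges F = ≤-trans (sum-mono-≤ (bit-any≤count ∘ (F ᵀ))) (≤-reflexive (edges-ᵀ F))

delete-⊑ᵉ : (x y : Fin n) (F : EdgeSet n) → delete x y F ⊑ᵉ F
delete-⊑ᵉ x y F a b Fab with F a b
... | true = refl

delete-keepsˡ : {x y a b : Fin n} (F : EdgeSet n) → a ≢ x → F a b ≡ true → delete x y F a b ≡ true
delete-keepsˡ F a≢x Fab rewrite Fab | ⁅⁆-≢ a≢x = refl

delete-keepsʳ : {x y a b : Fin n} (F : EdgeSet n) → b ≢ y → F a b ≡ true → delete x y F a b ≡ true
delete-keepsʳ {x = x} {a = a} F b≢y Fab rewrite Fab | ⁅⁆-≢ b≢y | ∧-zeroʳ (⁅ x ⁆ a) = refl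

edges-delete : {x y : Fin n} (F : EdgeSet n) → F x y ≡ true → edges (delete x y F) < edges F
edges-delete {x = x} {y} F Fxy =
  sum-mono-< (λ a → count-mono (delete-⊑ᵉ x y F a)) x
    (count-⊂ (delete-⊑ᵉ x y F x) y deleted Fxy)
  where
  deleted : delete x y F x y ≡ false
  deleted rewrite ⁅⁆-self x | ⁅⁆-self y = ∧-zeroʳ (F x y)

into : EdgeSet n → VSet n → VSet n
into F X b = any (λ a → X a ∧ F a b)

∂⁺ : EdgeSet n → VSet n → VSet n
∂⁺ F X = ∁ X ∩ into F X

into-intro : (F : EdgeSet n) (X : VSet n) {a b : Fin n} → X a ≡ true → F a b ≡ true → into F X b ≡ true
into-intro F X {a} {b} Xa Fab = any-intro (λ a' → X a' ∧ F a' b) a (cong₂ _∧_ Xa Fab)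

∂⁺-intro : (F : EdgeSet n) (X : VSet n) {a b : Fin n} →
           X a ≡ true → F a b ≡ true → X b ≡ false → ∂⁺ F X b ≡ true
∂⁺-intro F X Xa Fab Xb rewrite Xb = into-intro F X Xa Fab

∂⁺-elim : (F : EdgeSet n) (X : VSet n) {b : Fin n} →
          ∂⁺ F X b ≡ true → X b ≡ false × ∃[ a ] (X a ≡ true × F a b ≡ true)
∂⁺-elim F X {b} ∂b with X b
... | false with any-elim (λ a → X a ∧ F a b) ∂b
... | a , XFab = refl , a , ∧-conicalˡ _ _ XFab , ∧-conicalʳ _ _ XFab

∂⁺-mono : (F G : EdgeSet n) (X Y : VSet n) →
          (∀ a b → X a ≡ true → X b ≡ false → F a b ≡ true → Y a ≡ true × Y b ≡ false × G a b ≡ true) →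
          ∂⁺ F X ⊑ ∂⁺ G Y
∂⁺-mono F G X Y crossing b ∂b with ∂⁺-elim F X ∂b
... | Xb , a , Xa , Fab with crossing a b Xa Xb Fab
... | Ya , Yb , Gab = ∂⁺-intro G Y Ya Gab Yb

into-∩ : (F : EdgeSet n) (X Y : VSet n) → into F (X ∩ Y) ⊑ (into F X ∩ into F Y)
into-∩ F X Y b ∈into with any-elim (λ a → (X a ∧ Y a) ∧ F a b) ∈into
... | a , XYFab = cong₂ _∧_ (into-intro F X Xa Fab) (into-intro F Y Ya Fab)
  where
  XYa = ∧-conicalˡ (X a ∧ Y a) (F a b) XYFab
  Fab = ∧-conicalʳ (X a ∧ Y a) (F a b) XYFab
  Xa = ∧-conicalˡ (X a) (Y a) XYa
  Ya = ∧-conicalʳ (X a) (Y a) XYa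

into-∪ : (F : EdgeSet n) (X Y : VSet n) → into F (X ∪ Y) ⊑ (into F X ∪ into F Y)
into-∪ F X Y b ∈into with any-elim (λ a → (X a ∨ Y a) ∧ F a b) ∈into
... | a , XYFab with X a in Xa
... | true = cong (_∨ into F Y b) (into-intro F X Xa (∧-conicalʳ true (F a b) XYFab))
... | false = trans (cong (into F X b ∨_) (into-intro F Y Ya Fab)) (∨-zeroʳ (into F X b))
  where
  Ya = ∧-conicalˡ (Y a) (F a b) XYFab
  Fab = ∧-conicalʳ (Y a) (F a b) XYFab

∂⁺-submodular : (F : EdgeSet n) (X Y : VSet n) →
  count (∂⁺ F (X ∩ Y)) + count (∂⁺ F (X ∪ Y)) ≤ count (∂⁺ F X) + count (∂⁺ F Y)
∂⁺-submodular F X Y = begin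
  count (∂⁺ F (X ∩ Y)) + count (∂⁺ F (X ∪ Y))
    ≤⟨ +-mono-≤ (count-mono (∩-monoʳ (into-∩ F X Y))) (count-mono (∩-monoʳ (into-∪ F X Y))) ⟩
  count relaxed∩ + count relaxed∪
    ≡⟨ ∑-distrib-+ (bit ∘ relaxed∩) (bit ∘ relaxed∪) ⟨
  sum (λ b → bit (relaxed∩ b) + bit (relaxed∪ b))
    ≤⟨ sum-mono-≤ (λ b → bit-submodular (X b) (Y b) (into F X b) (into F Y b)) ⟩
  sum (λ b → bit (∂⁺ F X b) + bit (∂⁺ F Y b))
    ≡⟨ ∑-distrib-+ (bit ∘ ∂⁺ F X) (bit ∘ ∂⁺ F Y) ⟩
  count (∂⁺ F X) + count (∂⁺ F Y) ∎
  where
  open ≤-Reasoning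
  relaxed∩ relaxed∪ : VSet _
  relaxed∩ = ∁ (X ∩ Y) ∩ (into F X ∩ into F Y)
  relaxed∪ = ∁ (X ∪ Y) ∩ (into F X ∪ into F Y)

path-∷ʳ : {F : EdgeSet n} {S : Subset n} {u r z : Fin n} →
          PathAvoiding F S u r → F r z ≡ true → z ∉ S → PathAvoiding F S u z
path-∷ʳ (here r∉S) Frz z∉S = step r∉S Frz (here z∉S)
path-∷ʳ (step u∉S Fuw p) Frz z∉S = step u∉S Fuw (path-∷ʳ p Frz z∉S)

path-reverse : {F : EdgeSet n} {S : Subset n} {a b : Fin n} → PathAvoiding F S a b → PathAvoiding (F ᵀ) S b a
path-reverse (here a∉S) = here a∉S
path-reverse (step a∉S Faw p) = path-∷ʳ (path-reverse p) Faw a∉S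

path-mono : {F G : EdgeSet n} {S : Subset n} {a b : Fin n} → F ⊑ᵉ G → PathAvoiding F S a b → PathAvoiding G S a b
path-mono F⊑G (here a∉S) = here a∉S
path-mono F⊑G (step a∉S Faw p) = step a∉S (F⊑G _ _ Faw) (path-mono F⊑G p)

path-source∉ : {F : EdgeSet n} {S : Subset n} {a b : Fin n} → PathAvoiding F S a b → a ∉ S
path-source∉ (here a∉S) = a∉S
path-source∉ (step a∉S _ _) = a∉S

path-leaves : {F : EdgeSet n} {S : Subset n} {a b : Fin n} (X : VSet n) →
              PathAvoiding F S a b → X a ≡ true → X b ≡ false →
              ∃[ c ] ∃[ d ] (X c ≡ true × X d ≡ false × F c d ≡ true × d ∉ S)
path-leaves X (here _) Xa Xb with () ← trans (sym Xa) Xb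
path-leaves X (step {w = w} _ Faw p) Xa Xb with X w in Xw
... | true = path-leaves X p Xw Xb
... | false = _ , w , Xa , Xw , Faw , path-source∉ p

Connected : ℕ → EdgeSet n → Set
Connected {n} k F = ∀ (S : Subset n) → ∣ S ∣ < k → ∀ a b → a ∉ S → b ∉ S → PathAvoiding F S a b

connected-ᵀ : {k : ℕ} {F : EdgeSet n} → Connected k F → Connected k (F ᵀ)
connected-ᵀ conn S ∣S∣<k a b a∉S b∉S = path-reverse (conn S ∣S∣<k b a b∉S a∉S)

boundary-traps : (F : EdgeSet n) (X : VSet n) {a b : Fin n} →
                 PathAvoiding F (tabulate (∂⁺ F X)) a b → X a ≡ true → X b ≡ true
boundary-traps F X {b = b} p Xa with X b in Xb
... | true = refl
... | false with path-leaves X p Xa Xb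
... | c , d , Xc , Xd , Fcd , d∉∂X = ⊥-elim (d∉∂X (∈-tabulate (∂⁺-intro F X Xc Fcd Xd)))

module Expansion {n : ℕ} (k : ℕ) (U : VSet n) where

  Expanding : EdgeSet n → Set
  Expanding F = ∀ X → NonEmpty X → X ⊑ U → k ≤ count (∂⁺ F X)

  Bad : EdgeSet n → VSet n → Set
  Bad F X = NonEmpty X × X ⊑ U × count (∂⁺ F X) < k

  bad? : (F : EdgeSet n) → Dec (∃[ S ] Bad F (lookup S))
  bad? F = anySubset? λ S → any? (λ a → lookup S a ≟ᵇ true)
                        ×-dec all? (λ a → (lookup S a ≟ᵇ true) →-dec (U a ≟ᵇ true))
                        ×-dec (count (∂⁺ F (lookup S)) <? k)

  expanding-if-no-bad : (F : EdgeSet n) → ¬ (∃[ S ] Bad F (lookup S)) → Expanding F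
  expanding-if-no-bad F no-bad X (x , Xx) X⊑U = ≮⇒≥ λ ∂X<k →
    no-bad (tabulate X , (x , trans (S≗X x) Xx) , (λ i Si → X⊑U i (trans (sym (S≗X i)) Si)) ,
            ≤-<-trans (count-mono (∂⁺-mono F F (lookup (tabulate X)) X crossing)) ∂X<k)
    where
    S≗X = lookup∘tabulate X
    crossing : ∀ a b → lookup (tabulate X) a ≡ true → lookup (tabulate X) b ≡ false → F a b ≡ true →
               X a ≡ true × X b ≡ false × F a b ≡ true
    crossing a b Sa Sb Fab = trans (sym (S≗X a)) Sa , trans (sym (S≗X b)) Sb , Fab

  expanding-of-connected : (F : EdgeSet n) → count U + k ≤ n → Connected k F → Expanding F
  expanding-of-connected F U+k≤n conn X (x , Xx) X⊑U = ≮⇒≥ trapped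
    where
    ∂X : VSet n
    ∂X = ∂⁺ F X
    x∉∂X : ∂X x ≡ false
    x∉∂X rewrite Xx = refl
    X∪∂X-small : count ∂X < k → count (X ∪ ∂X) < count {n} (λ _ → true)
    X∪∂X-small ∂X<k = begin-strict
      count (X ∪ ∂X)      ≤⟨ count-∪ X ∂X ⟩
      count X + count ∂X  <⟨ +-mono-≤-< (count-mono X⊑U) ∂X<k ⟩
      count U + k         ≤⟨ U+k≤n ⟩
      n                   ≡⟨ count-full {n} ⟨
      count {n} (λ _ → true) ∎
      where open ≤-Reasoning
    trapped : count ∂X < k → ⊥
    trapped ∂X<k with count-<⇒∃ (λ _ → true) (X ∪ ∂X) (X∪∂X-small ∂X<k)
    ... | v , _ , X∪∂X∌v = not-¬ (∨-conicalˡ (X v) (∂X v) X∪∂X∌v) (boundary-traps F X x⇝v Xx)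
      where
      x⇝v : PathAvoiding F (tabulate ∂X) x v
      x⇝v = conn (tabulate ∂X) (≤-<-trans (≤-reflexive (∣tabulate∣≡count ∂X)) ∂X<k) x v
                 (∉-tabulate x∉∂X) (∉-tabulate (∨-conicalʳ (X v) (∂X v) X∪∂X∌v))

  Escapes : EdgeSet n → Set
  Escapes F = ∀ (S : Subset n) → ∣ S ∣ < k → ∀ u → U u ≡ true → u ∉ S →
              ∃[ y ] (U y ≡ false × heads F y ≡ true × PathAvoiding F S u y)

  expanding⇒escapes : (F : EdgeSet n) → Expanding F → Escapes F
  expanding⇒escapes F expF S ∣S∣<k u Uu u∉S = proj₂ (proj₂ (descend unexplored grow start))
    where
    Explored : VSet n → Set
    Explored R = R ⊑ U × R u ≡ true × (∀ r → R r ≡ true → PathAvoiding F S u r)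

    Exit : Set
    Exit = ∃[ y ] (U y ≡ false × heads F y ≡ true × PathAvoiding F S u y)

    unexplored : VSet n → ℕ
    unexplored R = count (U ∩ ∁ R)

    start : Explored ⁅ u ⁆
    start = (λ i u∋i → subst (λ j → U j ≡ true) (sym (⁅⁆-sound u∋i)) Uu)
          , ⁅⁆-self u
          , (λ r u∋r → subst (PathAvoiding F S u) (sym (⁅⁆-sound u∋r)) (here u∉S))

    S<k : count (lookup S) < k
    S<k = subst (_< k) (∣∣≡count S) ∣S∣<k

    grow : ∀ R → Explored R → Exit ⊎ ∃[ R' ] (Explored R' × unexplored R' < unexplored R)
    grow R (R⊑U , Ru , reach) with count-<⇒∃ (∂⁺ F R) (lookup S) (<-≤-trans S<k (expF R (u , Ru) R⊑U))
    ... | z , ∂Rz , Sz with ∂⁺-elim F R ∂Rz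
    ... | Rz , r , Rr , Frz with U z in Uz | path-∷ʳ (reach r Rr) Frz (lookup≡false⇒∉ Sz)
    ... | false | u⇝z = inj₁ (z , Uz , any-intro ((F ᵀ) z) r Frz , u⇝z)
    ... | true | u⇝z = inj₂ (R ∪ ⁅ z ⁆ , (R'⊑U , cong (_∨ ⁅ z ⁆ u) Ru , reach') , shrinks)
      where
      R'⊑U : (R ∪ ⁅ z ⁆) ⊑ U
      R'⊑U = ∪-⊑ R⊑U (λ i z∋i → subst (λ j → U j ≡ true) (sym (⁅⁆-sound z∋i)) Uz)
      reach' : ∀ i → (R ∪ ⁅ z ⁆) i ≡ true → PathAvoiding F S u i
      reach' i R'i with ∪⁅⁆-elim R R'i
      ... | inj₁ Ri = reach i Ri
      ... | inj₂ refl = u⇝z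
      z-explored : (U ∩ ∁ (R ∪ ⁅ z ⁆)) z ≡ false
      z-explored rewrite ⁅⁆-self z | ∨-zeroʳ (R z) = ∧-zeroʳ (U z)
      z-unexplored : (U ∩ ∁ R) z ≡ true
      z-unexplored rewrite Uz | Rz = refl
      shrinks : unexplored (R ∪ ⁅ z ⁆) < unexplored R
      shrinks = count-⊂ (∩-monoʳ (∁-antitone (⊑-∪ˡ R ⁅ z ⁆))) z z-explored z-unexplored

  Critical : EdgeSet n → Set
  Critical F = ∀ a b → F a b ≡ true → ∃[ X ] Bad (delete a b F) X

  Tight : EdgeSet n → Fin n → VSet n → Set
  Tight F x X = X x ≡ true × X ⊑ U × count (∂⁺ F X) ≤ k

  tight-∩ : (F : EdgeSet n) {x : Fin n} {X Y : VSet n} → Expanding F → Tight F x X → Tight F x Y → Tight F x (X ∩ Y)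
  tight-∩ F {x} {X} {Y} expF (Xx , X⊑U , ∂X≤k) (Yx , Y⊑U , ∂Y≤k) =
    cong₂ _∧_ Xx Yx , (λ i XYi → X⊑U i (∩-⊑ˡ X Y i XYi)) , ∂X∩Y≤k
    where
    k≤∂X∪Y : k ≤ count (∂⁺ F (X ∪ Y))
    k≤∂X∪Y = expF (X ∪ Y) (x , cong (_∨ Y x) Xx) (∪-⊑ X⊑U Y⊑U)
    ∂X∩Y≤k : count (∂⁺ F (X ∩ Y)) ≤ k
    ∂X∩Y≤k = +-cancelʳ-≤ k _ k (begin
      count (∂⁺ F (X ∩ Y)) + k                      ≤⟨ +-monoʳ-≤ _ k≤∂X∪Y ⟩
      count (∂⁺ F (X ∩ Y)) + count (∂⁺ F (X ∪ Y))   ≤⟨ ∂⁺-submodular F X Y ⟩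
      count (∂⁺ F X) + count (∂⁺ F Y)               ≤⟨ +-mono-≤ ∂X≤k ∂Y≤k ⟩
      k + k                                         ∎)
      where open ≤-Reasoning

  bad-after-delete⇒tight : (F : EdgeSet n) {x y : Fin n} {X : VSet n} →
                           Expanding F → Bad (delete x y F) X → Tight F x X × X y ≡ false
  bad-after-delete⇒tight F {x} {y} {X} expF (nonempty , X⊑U , ∂'X<k) = (Xx , X⊑U , ∂X≤k) , Xy
    where
    F' = delete x y F

    ∂X⊑∂'X∪y : ∂⁺ F X ⊑ (∂⁺ F' X ∪ ⁅ y ⁆)
    ∂X⊑∂'X∪y b ∂Xb with ∂⁺-elim F X ∂Xb
    ... | Xb , a , Xa , Fab = ∪⁅⁆-intro (∂⁺ F' X) (λ b≢y → ∂⁺-intro F' X Xa (delete-keepsʳ F b≢y Fab) Xb)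

    ∂X≤k : count (∂⁺ F X) ≤ k
    ∂X≤k = begin
      count (∂⁺ F X)                    ≤⟨ count-mono ∂X⊑∂'X∪y ⟩
      count (∂⁺ F' X ∪ ⁅ y ⁆)           ≤⟨ count-∪ (∂⁺ F' X) ⁅ y ⁆ ⟩
      count (∂⁺ F' X) + count ⁅ y ⁆     ≡⟨ cong (count (∂⁺ F' X) +_) (count-⁅⁆ y) ⟩
      count (∂⁺ F' X) + 1               ≡⟨ +-comm _ 1 ⟩
      suc (count (∂⁺ F' X))             ≤⟨ ∂'X<k ⟩
      k                                 ∎
      where open ≤-Reasoning

    deletion-harmless : (∀ a b → X a ≡ true → X b ≡ false → F a b ≡ true → F' a b ≡ true) → ⊥
    deletion-harmless keeps = <⇒≱ ∂'X<k (≤-trans (expF X nonempty X⊑U) (count-mono (∂⁺-mono F F' X X crossing)))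
      where
      crossing = λ a b Xa Xb Fab → Xa , Xb , keeps a b Xa Xb Fab

    Xx : X x ≡ true
    Xx with X x in X∌x
    ... | true = refl
    ... | false = ⊥-elim (deletion-harmless λ a b Xa _ → delete-keepsˡ F (separated⇒≢ X Xa X∌x))

    Xy : X y ≡ false
    Xy with X y in X∋y
    ... | false = refl
    ... | true = ⊥-elim (deletion-harmless λ a b _ Xb → delete-keepsʳ F (λ b≡y → separated⇒≢ X X∋y Xb (sym b≡y)))

  tight-shrink : (F : EdgeSet n) {x : Fin n} → Expanding F → Critical F → ∀ T → Tight F x T →
                 (∀ y → F x y ≡ true → T y ≡ false) ⊎ ∃[ T' ] (Tight F x T' × count T' < count T)
  tight-shrink F {x} expF crit T tightT with any? (λ y → (F x y ≟ᵇ true) ×-dec (T y ≟ᵇ true))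
  ... | no none = inj₁ (λ y Fxy → ¬-not (λ Ty → none (y , Fxy , Ty)))
  ... | yes (y , Fxy , Ty) with crit x y Fxy
  ... | X , bad with bad-after-delete⇒tight F expF bad
  ... | tightX , Xy = inj₂ (T ∩ X , tight-∩ F expF tightT tightX , count-⊂ (∩-⊑ˡ T X) y T∩X∌y Ty)
    where
    T∩X∌y : T y ∧ X y ≡ false
    T∩X∌y rewrite Xy = ∧-zeroʳ (T y)

  out-degree≤k : (F : EdgeSet n) → Expanding F → Critical F → ∀ x → count (F x) ≤ k
  out-degree≤k F expF crit x with any? (λ y → F x y ≟ᵇ true)
  ... | no no-edge = ≤-trans (count-mono (λ y Fxy → ⊥-elim (no-edge (y , Fxy)))) (≤-trans (≤-reflexive (count-∅ {n})) z≤n)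
  ... | yes (y , Fxy) with crit x y Fxy
  ... | X , bad with descend count (tight-shrink F expF crit) (proj₁ (bad-after-delete⇒tight F expF bad))
  ... | T , (Tx , _ , ∂T≤k) , T∌N⁺x = ≤-trans (count-mono (λ z Fxz → ∂⁺-intro F T Tx Fxz (T∌N⁺x z Fxz))) ∂T≤k

  prune : (F₀ : EdgeSet n) → Expanding F₀ → ∃[ F ] ((F ⊑ᵉ F₀ × Expanding F) × Critical F)
  prune F₀ exp₀ = descend edges delete-redundant-edge ((λ _ _ F₀ab → F₀ab) , exp₀)
    where
    delete-redundant-edge : ∀ F → F ⊑ᵉ F₀ × Expanding F →
                            Critical F ⊎ ∃[ F' ] ((F' ⊑ᵉ F₀ × Expanding F') × edges F' < edges F)
    delete-redundant-edge F (F⊑F₀ , expF)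
      with any? (λ a → any? (λ b → (F a b ≟ᵇ true) ×-dec ¬? (bad? (delete a b F))))
    ... | yes (a , b , Fab , no-bad) =
      inj₂ (delete a b F , (F'⊑F₀ , expanding-if-no-bad _ no-bad) , edges-delete F Fab)
      where
      F'⊑F₀ : delete a b F ⊑ᵉ F₀
      F'⊑F₀ c d F'cd = F⊑F₀ c d (delete-⊑ᵉ a b F c d F'cd)
    ... | no none = inj₁ critical
      where
      critical : Critical F
      critical a b Fab with bad? (delete a b F)
      ... | yes (S , bad) = lookup S , bad
      ... | no no-bad = ⊥-elim (none (a , b , Fab , no-bad))

  fromU : EdgeSet n → EdgeSet n
  fromU A a b = U a ∧ A a b

  expanding-fromU : (A : EdgeSet n) → Expanding A → Expanding (fromU A)
  expanding-fromU A expA X nonempty X⊑U = ≤-trans (expA X nonempty X⊑U)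
    (count-mono (∂⁺-mono A (fromU A) X X (λ a b Xa Xb Aab → Xa , Xb , cong₂ _∧_ (X⊑U a Xa) Aab)))

  SparseEscaping : EdgeSet n → Set
  SparseEscaping A = ∃[ F ] (F ⊑ᵉ A × edges F ≤ k * count U × Escapes F)

  sparse-escaping-subgraph : (A : EdgeSet n) → Expanding A → SparseEscaping A
  sparse-escaping-subgraph A expA with prune (fromU A) (expanding-fromU A expA)
  ... | F , (F⊑A∩U , expF) , critF =
    F , (λ a b Fab → ∧-conicalʳ (U a) (A a b) (F⊑A∩U a b Fab)) , edge-bound , expanding⇒escapes F expF
    where
    out-degree : ∀ a → count (F a) ≤ k * bit (U a)
    out-degree a with U a in Ua
    ... | true = subst (count (F a) ≤_) (sym (*-identityʳ k)) (out-degree≤k F expF critF a)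
    ... | false = ≤-trans (count-mono (λ b Fab → trans (sym (cong (_∧ A a b) Ua)) (F⊑A∩U a b Fab)))
                          (≤-reflexive (trans (count-∅ {n}) (sym (*-zeroʳ k))))
    edge-bound : edges F ≤ k * count U
    edge-bound = ≤-trans (sum-mono-≤ out-degree) (≤-reflexive (sym (*-distribˡ-sum k (bit ∘ U))))

double : ∀ k m → k * m + k * m ≡ 2 * k * m
double = solve 2 (λ k m → k :* m :+ k :* m := con 2 :* k :* m) refl
  where open +-*-Solver

module _ (k : ℕ) (D : Digraph) (U : Subset (N D)) (1≤k : 1 ≤ k) where
  open Expansion k (lookup U)

  escaper-of-sparse-pair : SparseEscaping (adj D) → SparseEscaping (adj D ᵀ) →
    ∃[ E ] ∃[ Uout ] (IsEscaper k D E U Uout × edgeCount E ≤ 4 * k * ∣ U ∣ × ∣ Uout ∣ ≤ 2 * k * ∣ U ∣)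
  escaper-of-sparse-pair (F₁ , F₁⊑A , F₁-edges , F₁-escapes) (F₂ , F₂⊑Aᵀ , F₂-edges , F₂-escapes) =
    E , tabulate Out , escaper , edge-bound , out-bound
    where
    E : EdgeSet (N D)
    E = F₁ ∪ᵉ F₂ ᵀ

    Out : VSet (N D)
    Out = ∁ (lookup U) ∩ (heads F₁ ∪ heads F₂)

    sizes : edges F₁ + edges F₂ ≤ 2 * k * ∣ U ∣
    sizes = begin
      edges F₁ + edges F₂                    ≤⟨ +-mono-≤ F₁-edges F₂-edges ⟩
      k * count (lookup U) + k * count (lookup U)  ≡⟨ double k (count (lookup U)) ⟩
      2 * k * count (lookup U)               ≡⟨ cong (2 * k *_) (∣∣≡count U) ⟨
      2 * k * ∣ U ∣                          ∎
      where open ≤-Reasoning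

    edge-bound : edgeCount E ≤ 4 * k * ∣ U ∣
    edge-bound = begin
      edgeCount E              ≡⟨ edgeCount≡edges E ⟩
      edges E                  ≤⟨ edges-∪ᵉ F₁ (F₂ ᵀ) ⟩
      edges F₁ + edges (F₂ ᵀ)  ≡⟨ cong (edges F₁ +_) (edges-ᵀ F₂) ⟩
      edges F₁ + edges F₂      ≤⟨ sizes ⟩
      2 * k * ∣ U ∣            ≤⟨ *-monoˡ-≤ ∣ U ∣ (*-monoˡ-≤ k (m≤m+n 2 2)) ⟩
      4 * k * ∣ U ∣            ∎
      where open ≤-Reasoning

    out-bound : ∣ tabulate Out ∣ ≤ 2 * k * ∣ U ∣
    out-bound = begin
      ∣ tabulate Out ∣                        ≡⟨ ∣tabulate∣≡count Out ⟩
      count Out                               ≤⟨ count-mono (∩-⊑ʳ (∁ (lookup U)) (heads F₁ ∪ heads F₂)) ⟩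
      count (heads F₁ ∪ heads F₂)             ≤⟨ count-∪ (heads F₁) (heads F₂) ⟩
      count (heads F₁) + count (heads F₂)     ≤⟨ +-mono-≤ (count-heads≤edges F₁) (count-heads≤edges F₂) ⟩
      edges F₁ + edges F₂                     ≤⟨ sizes ⟩
      2 * k * ∣ U ∣                           ∎
      where open ≤-Reasoning

    ≤∸1⇒< : ∀ {m} → m ≤ k ∸ 1 → m < k
    ≤∸1⇒< {m} m≤k∸1 = subst (_≤ k) (+-comm m 1) (m≤o∸n⇒m+n≤o m 1≤k m≤k∸1)

    ∈-Out : ∀ {y} → lookup U y ≡ false → (heads F₁ ∪ heads F₂) y ≡ true → y ∈ tabulate Out
    ∈-Out Uy heads∋y = ∈-tabulate (cong₂ _∧_ (cong not Uy) heads∋y)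

    Out∩U≡∅ : ∀ x → x ∈ tabulate Out → x ∉ U
    Out∩U≡∅ x x∈Out x∈U with () ← trans (cong not (sym ([]=⇒lookup x∈U))) (∧-conicalˡ _ _ (∈-tabulate⁻ x∈Out))

    forward : ∀ (S : Subset (N D)) → ∣ S ∣ ≤ k ∸ 1 → ∀ u → u ∈ U → u ∉ S →
              ∃[ w ] (w ∈ tabulate Out × PathAvoiding E S u w)
    forward S ∣S∣≤k∸1 u u∈U u∉S with F₁-escapes S (≤∸1⇒< ∣S∣≤k∸1) u ([]=⇒lookup u∈U) u∉S
    ... | y , Uy , F₁∋y , p = y , ∈-Out Uy (⊑-∪ˡ (heads F₁) (heads F₂) y F₁∋y) , path-mono (λ a → ⊑-∪ˡ (F₁ a) _) p

    backward : ∀ (S : Subset (N D)) → ∣ S ∣ ≤ k ∸ 1 → ∀ v → v ∈ U → v ∉ S →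
               ∃[ w ] (w ∈ tabulate Out × PathAvoiding E S w v)
    backward S ∣S∣≤k∸1 v v∈U v∉S with F₂-escapes S (≤∸1⇒< ∣S∣≤k∸1) v ([]=⇒lookup v∈U) v∉S
    ... | y , Uy , F₂∋y , p =
      y , ∈-Out Uy (⊑-∪ʳ (heads F₁) (heads F₂) y F₂∋y) , path-mono (λ a → ⊑-∪ʳ (F₁ a) _) (path-reverse p)

    escaper : IsEscaper k D E U (tabulate Out)
    escaper = record
      { E⊆ = ∪ᵉ-⊑ᵉ F₁⊑A (λ a b → F₂⊑Aᵀ b a)
      ; E1 = Out∩U≡∅
      ; E2 = forward
      ; E3 = backward
      }

lemma5p7 : (k n : ℕ) → 1 ≤ k → 1 ≤ n → (D : Digraph) → StronglyKConnected k D →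
    (U : Subset (N D)) → ∣ U ∣ ≤ N D ∸ k →
    ∃[ E ] ∃[ Uout ] (IsEscaper k D E U Uout × edgeCount E ≤ 4 * k * ∣ U ∣ × ∣ Uout ∣ ≤ 2 * k * ∣ U ∣)
lemma5p7 k _ 1≤k _ D (k+1≤N , strongly-connected) U ∣U∣≤N∸k =
  escaper-of-sparse-pair k D U 1≤k
    (sparse-escaping-subgraph (adj D) (expanding-of-connected (adj D) U+k≤N connected))
    (sparse-escaping-subgraph (adj D ᵀ) (expanding-of-connected (adj D ᵀ) U+k≤N (connected-ᵀ connected)))
  where
  open Expansion k (lookup U)

  connected : Connected k (adj D)
  connected S ∣S∣<k = strongly-connected S (m+n≤o⇒m≤o∸n ∣ S ∣ (subst (_≤ k) (+-comm 1 ∣ S ∣) ∣S∣<k))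

  U+k≤N : count (lookup U) + k ≤ N D
  U+k≤N = subst (λ c → c + k ≤ N D) (∣∣≡count U) (m≤o∸n⇒m+n≤o ∣ U ∣ (≤-trans (m≤m+n k 1) k+1≤N) ∣U∣≤N∸k)
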